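{- Let $\mathcal{L}_{\rhd}$ be the language given by $\varphi ::= \bot \mid \top \mid p \mid \varphi\wedge\varphi \mid \varphi\vee\varphi \mid {\rhd}\varphi$ with $p$ ranging over a countable set of propositional variables. Then the class of enriched formal $\mathcal{L}_{\rhd}$-contexts $\mathbb{F}=(\mathbb{P},R_{\rhd})$ such that $R_{\rhd}\subseteq A\times A$ is reflexive is not modally definable in $\mathcal{L}_{\rhd}$; that is, there is no set $\Sigma$ of $\mathcal{L}_{\rhd}$-sequents $\varphi\vdash\psi$ such that for every enriched formal $\mathcal{L}_{\rhd}$-context $\mathbb{F}$, $\mathbb{F}$ validates all sequents in $\Sigma$ iff $R_{\rhd}$ is reflexive. Likewise, the class of enriched formal $\mathcal{L}_{\rhd}$-contexts such that $R_{\rhd}$ is transitive is not modally definable in $\mathcal{L}_{\rhd}$.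
   Context: A polarity is a triple $\mathbb{P}=(A,X,I)$ with $I\subseteq A\times X$. For $T\subseteq U\times V$, $U'\subseteq U$, $V'\subseteq V$, put $T^{(1)}[U']=\{v\mid \forall u\in U'\, uTv\}$ and $T^{(0)}[V']=\{u\mid \forall v\in V'\, uTv\}$; write $B^{\uparrow}=I^{(1)}[B]$ for $B\subseteq A$ and $Y^{\downarrow}=I^{(0)}[Y]$ for $Y\subseteq X$. A set $B\subseteq A$ is Galois-stable if $B=B^{\uparrow\downarrow}$ (similarly for $Y\subseteq X$ with $Y=Y^{\downarrow\uparrow}$). A formal concept is a pair $(B,Y)$ with $B=Y^{\downarrow}$, $Y=B^{\uparrow}$; these form the complete lattice $\mathbb{P}^+$ ordered by inclusion of first components. An enriched formal $\mathcal{L}_{\rhd}$-context is $\mathbb{F}=(\mathbb{P},R_{\rhd})$ with $R_{\rhd}\subseteq A\times A$ $I$-compatible, i.e. for all $a,b\in A$ the sets $R_{\rhd}^{(0)}[\{b\}]$ and $R_{\rhd}^{(1)}[\{a\}]$ are Galois-stable. A valuation $V$ assigns to each propositional variable a formal concept; it extends to formulas via extensions $[\![\cdot]\!]$ and intensions $(\![\cdot]\!)$ with $(\![\varphi]\!)=[\![\varphi]\!]^{\uparrow}$ and: $[\![p]\!]$ the extension of $V(p)$; $[\![\top]\!]=A$; $[\![\bot]\!]=X^{\downarrow}$; $[\![\varphi\wedge\psi]\!]=[\![\varphi]\!]\cap[\![\psi]\!]$; $[\![\varphi\vee\psi]\!]=((\![\varphi]\!)\cap(\![\psi]\!))^{\downarrow}$;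 $[\![{\rhd}\varphi]\!]=R_{\rhd}^{(0)}[[\![\varphi]\!]]=\{a\in A\mid \forall b\,(b\in[\![\varphi]\!]\Rightarrow aR_{\rhd}b)\}$. A sequent $\varphi\vdash\psi$ is valid on $\mathbb{F}$ if $[\![\varphi]\!]\subseteq[\![\psi]\!]$ for every valuation $V$ on $\mathbb{F}$. -}

module Defs where

open import Data.Nat using (ℕ)
open import Data.Product using (Σ; _×_; _,_)
open import Function.Bundles using (_⇔_)
open import Data.Unit using (⊤)

Pred : Set → Set₁
Pred A = A → Set

_⊆_ : {A : Set} → Pred A → Pred A → Set
B ⊆ C = ∀ a → B a → C a

_≐_ : {A : Set} → Pred A → Pred A → Set
B ≐ C = (B ⊆ C) × (C ⊆ B)

record Polarity : Set₁ where
  field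
    A : Set
    X : Set
    I : A → X → Set

T1 : {U V : Set} → (U → V → Set) → Pred U → Pred V
T1 T U' v = ∀ u → U' u → T u v

T0 : {U V : Set} → (U → V → Set) → Pred V → Pred U
T0 T V' u = ∀ v → V' v → T u v

module _ (P : Polarity) where
  open Polarity P

  up : Pred A → Pred X
  up B = T1 I B

  down : Pred X → Pred A
  down Y = T0 I Y

  GaloisStableA : Pred A → Set
  GaloisStableA B = B ≐ down (up B)

  GaloisStableX : Pred X → Set
  GaloisStableX Y = Y ≐ up (down Y)

  record Concept : Set₁ where
    field
      ext : Pred A
      int : Pred X
      ext-eq : ext ≐ down int
      int-eq : int ≐ up ext

record Context : Set₁ where
  field
    pol : Polarity
  open Polarity pol public
  field
    R : A → A → Set
    compat₀ : ∀ b → GaloisStableA pol (λ a → R a b)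
    compat₁ : ∀ a → GaloisStableA pol (λ b → R a b)

data Fml : Set where
  ⊥' ⊤' : Fml
  var : ℕ → Fml
  _∧'_ _∨'_ : Fml → Fml → Fml
  ▷ : Fml → Fml

Sequent : Set
Sequent = Σ Fml (λ _ → Fml)

module _ (F : Context) where
  open Context F

  Valuation : Set₁
  Valuation = ℕ → Concept pol

  ⟦_⟧ : Fml → Valuation → Pred A
  ⟦ ⊥' ⟧ V = down pol (λ _ → ⊤)
  ⟦ ⊤' ⟧ V = λ _ → ⊤
  ⟦ var p ⟧ V = Concept.ext (V p)
  ⟦ φ ∧' ψ ⟧ V = λ a → ⟦ φ ⟧ V a × ⟦ ψ ⟧ V a
  ⟦ φ ∨' ψ ⟧ V = down pol (λ x → up pol (⟦ φ ⟧ V) x × up pol (⟦ ψ ⟧ V) x)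
  ⟦ ▷ φ ⟧ V = T0 R (⟦ φ ⟧ V)

  ValidSeq : Sequent → Set₁
  ValidSeq (φ , ψ) = ∀ (V : Valuation) → ⟦ φ ⟧ V ⊆ ⟦ ψ ⟧ V

  ValidSet : (Sequent → Set) → Set₁
  ValidSet S = ∀ s → S s → ValidSeq s

  Reflexive : Set
  Reflexive = ∀ a → R a a

  Transitive : Set
  Transitive = ∀ a b c → R a b → R b c → R a c

ModallyDefinable : (Context → Set) → Set₁
ModallyDefinable K = Σ (Sequent → Set) (λ S → ∀ (F : Context) → ValidSet F S ⇔ K F)

-- Validity of a sequent on a context only depends on its complex algebra of concepts. If
-- f : A_F → A_G is such that B ↦ B ∘ f embeds G⁺ into F⁺ as an L▷-algebra, then
-- ⟦φ⟧_G ∘ f = ⟦φ⟧_F for pulled-back valuations, so every sequent valid on F is valid on G.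
-- For reflexivity, F is the two-point polarity with I the inequality and R the identity, and
-- G adds a point ∗ with no I-edges and no R-edges: a concept containing ∗ is the top one, so
-- ∗ is invisible to G⁺ ≅ F⁺, yet ∗ is irreflexive. For transitivity, F is a single point with
-- I and R empty, and G adds a point `top` that is I-related to everything, hence lies in every
-- concept; R relates everything except the copy of F's point to itself, so copy R top R copy
-- fails to compose.
module Submission where

open import Defs
open import Data.Empty using (⊥; ⊥-elim)
open import Data.Product using (Σ; _×_; _,_; proj₁; proj₂)
open import Data.Unit using (⊤; tt)
open import Function using (_∘_; id)
open import Function.Bundles using (Equivalence)
open import Relation.Binary.PropositionalEquality using (_≡_; refl)
open import Relation.Nullary using (¬_)

module _ {A : Set} where

  _∩_ : Pred A → Pred A → Pred A
  (B ∩ C) a = B a × C a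

  ⊆-trans : {B C D : Pred A} → B ⊆ C → C ⊆ D → B ⊆ D
  ⊆-trans B⊆C C⊆D a = C⊆D a ∘ B⊆C a

  ≐-refl : {B : Pred A} → B ≐ B
  ≐-refl = (λ _ → id) , (λ _ → id)

  ≐-sym : {B C : Pred A} → B ≐ C → C ≐ B
  ≐-sym (B⊆C , C⊆B) = C⊆B , B⊆C

  ≐-trans : {B C D : Pred A} → B ≐ C → C ≐ D → B ≐ D
  ≐-trans (B⊆C , C⊆B) (C⊆D , D⊆C) = ⊆-trans B⊆C C⊆D , ⊆-trans D⊆C C⊆B

  ∩-resp-≐ : {B B′ C C′ : Pred A} → B ≐ B′ → C ≐ C′ → (B ∩ C) ≐ (B′ ∩ C′)
  ∩-resp-≐ (B⊆B′ , B′⊆B) (C⊆C′ , C′⊆C) =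
    (λ a (Ba , Ca) → B⊆B′ a Ba , C⊆C′ a Ca) , (λ a (B′a , C′a) → B′⊆B a B′a , C′⊆C a C′a)

module _ {U V : Set} (T : U → V → Set) where

  T1-antitone : {B C : Pred U} → B ⊆ C → T1 T C ⊆ T1 T B
  T1-antitone B⊆C v v∈TC u Bu = v∈TC u (B⊆C u Bu)

  T0-antitone : {Y Z : Pred V} → Y ⊆ Z → T0 T Z ⊆ T0 T Y
  T0-antitone Y⊆Z u u∈TZ v Yv = u∈TZ v (Y⊆Z v Yv)

  T1-resp-≐ : {B C : Pred U} → B ≐ C → T1 T B ≐ T1 T C
  T1-resp-≐ (B⊆C , C⊆B) = T1-antitone C⊆B , T1-antitone B⊆C

  T0-resp-≐ : {Y Z : Pred V} → Y ≐ Z → T0 T Y ≐ T0 T Z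
  T0-resp-≐ (Y⊆Z , Z⊆Y) = T0-antitone Z⊆Y , T0-antitone Y⊆Z

module Galois (P : Polarity) where
  open Polarity P

  closure-monotone : {B C : Pred A} → B ⊆ C → down P (up P B) ⊆ down P (up P C)
  closure-monotone = T0-antitone I ∘ T1-antitone I

  ⊆-down-up : (B : Pred A) → B ⊆ down P (up P B)
  ⊆-down-up B a Ba x x∈B↑ = x∈B↑ a Ba

  ⊆-up-down : (Y : Pred X) → Y ⊆ up P (down P Y)
  ⊆-up-down Y x Yx a a∈Y↓ = a∈Y↓ x Yx

  closed⇒stable : {B : Pred A} → down P (up P B) ⊆ B → GaloisStableA P B
  closed⇒stable {B} closed = ⊆-down-up B , closed

  down-stable : (Y : Pred X) → GaloisStableA P (down P Y)
  down-stable Y = closed⇒stable (T0-antitone I (⊆-up-down Y))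

  full-stable : GaloisStableA P (λ _ → ⊤)
  full-stable = closed⇒stable λ _ _ → tt

  stable-resp-≐ : {B C : Pred A} → B ≐ C → GaloisStableA P B → GaloisStableA P C
  stable-resp-≐ (B⊆C , C⊆B) (_ , B-closed) =
    closed⇒stable (⊆-trans (closure-monotone C⊆B) (⊆-trans B-closed B⊆C))

  ∩-stable : {B C : Pred A} → GaloisStableA P B → GaloisStableA P C → GaloisStableA P (B ∩ C)
  ∩-stable (_ , B-closed) (_ , C-closed) = closed⇒stable λ a a∈cl →
    B-closed a (closure-monotone (λ _ → proj₁) a a∈cl) ,
    C-closed a (closure-monotone (λ _ → proj₂) a a∈cl)

  ext-stable : (C : Concept P) → GaloisStableA P (Concept.ext C)
  ext-stable C = stable-resp-≐ (≐-sym (Concept.ext-eq C)) (down-stable (Concept.int C))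

  stableConcept : (B : Pred A) → GaloisStableA P B → Concept P
  stableConcept B B-stable = record
    { ext = B ; int = up P B ; ext-eq = B-stable ; int-eq = ≐-refl }

  stable-∋-isolated⇒full : {B : Pred A} {z : A} → GaloisStableA P B →
                            (∀ x → ¬ I z x) → B z → ∀ a → B a
  stable-∋-isolated⇒full (_ , B-closed) isolated Bz a =
    B-closed a λ x x∈B↑ → ⊥-elim (isolated x (x∈B↑ _ Bz))

symmetricContext : (P : Polarity) (R : Polarity.A P → Polarity.A P → Set) →
                   (∀ a b → R a b → R b a) →
                   (∀ b → GaloisStableA P (λ a → R a b)) → Context
symmetricContext P R R-sym column-stable = record
  { pol = P
  ; R = R
  ; compat₀ = column-stable
  ; compat₁ = λ a → stable-resp-≐ ((λ b → R-sym b a) , R-sym a) (column-stable a)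
  }
  where open Galois P

module _ (F : Context) where
  open Context F
  open Galois pol

  ▷-stable : (B : Pred A) → GaloisStableA pol (T0 R B)
  ▷-stable B = closed⇒stable λ a a∈cl b Bb →
    proj₂ (compat₀ b) a (closure-monotone (λ _ a▷B → a▷B b Bb) a a∈cl)

  ⟦⟧-stable : (φ : Fml) (V : Valuation F) → GaloisStableA pol (⟦_⟧ F φ V)
  ⟦⟧-stable ⊥'       V = down-stable _
  ⟦⟧-stable ⊤'       V = full-stable
  ⟦⟧-stable (var n)  V = ext-stable (V n)
  ⟦⟧-stable (φ ∧' ψ) V = ∩-stable (⟦⟧-stable φ V) (⟦⟧-stable ψ V)
  ⟦⟧-stable (φ ∨' ψ) V = down-stable _
  ⟦⟧-stable (▷ φ)    V = ▷-stable _

-- The two density fields say that the points of G outside the image of onA are determined by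
-- that image; together with the rest they make B ↦ B ∘ onA an embedding of G⁺ into F⁺.
module _ (F G : Context) where
  private
    module F = Context F
    module G = Context G

  record DenseMorphism : Set₁ where
    field
      onA            : F.A → G.A
      onX            : F.X → G.X
      onX-surjective : ∀ y → Σ F.X (λ x → onX x ≡ y)
      I-preserve     : ∀ {a x} → F.I a x → G.I (onA a) (onX x)
      I-reflect      : ∀ {a x} → G.I (onA a) (onX x) → F.I a x
      R-reflect      : ∀ {a b} → G.R (onA a) (onA b) → F.R a b
      up-dense       : ∀ {B} → GaloisStableA G.pol B → up F.pol (B ∘ onA) ⊆ (up G.pol B ∘ onX)
      ▷-dense        : ∀ {B} → GaloisStableA G.pol B → T0 F.R (B ∘ onA) ⊆ (T0 G.R B ∘ onA)

module Pullback {F G : Context} (m : DenseMorphism F G) where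
  open DenseMorphism m
  private
    module F where
      open Context F public
      open Galois pol public
    module G where
      open Context G public
      open Galois pol public

  pullback-down : (Y : Pred G.X) → (down G.pol Y ∘ onA) ≐ down F.pol (Y ∘ onX)
  pullback-down Y = (λ a a∈Y↓ x Yx → I-reflect (a∈Y↓ (onX x) Yx)) , ⊇
    where
    ⊇ : down F.pol (Y ∘ onX) ⊆ (down G.pol Y ∘ onA)
    ⊇ a a∈Y↓ y Yy with onX-surjective y
    ... | x , refl = I-preserve (a∈Y↓ x Yy)

  pullback-up : {B : Pred G.A} → GaloisStableA G.pol B →
                up F.pol (B ∘ onA) ≐ (up G.pol B ∘ onX)
  pullback-up B-stable = up-dense B-stable , λ x x∈B↑ a Ba → I-reflect (x∈B↑ (onA a) Ba)

  pullback-stable : {B : Pred G.A} → GaloisStableA G.pol B → GaloisStableA F.pol (B ∘ onA)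
  pullback-stable {B} B-stable = F.closed⇒stable λ a a∈cl →
    proj₂ B-stable (onA a)
      (proj₂ (pullback-down (up G.pol B)) a
        (T0-antitone F.I (proj₂ (pullback-up B-stable)) a a∈cl))

  pullback-reflects-⊆ : {B C : Pred G.A} → GaloisStableA G.pol B → GaloisStableA G.pol C →
                        (B ∘ onA) ⊆ (C ∘ onA) → B ⊆ C
  pullback-reflects-⊆ {B} {C} B-stable C-stable Bf⊆Cf b Bb = proj₂ C-stable b b∈cl
    where
    b∈cl : down G.pol (up G.pol C) b
    b∈cl y y∈C↑ with onX-surjective y
    ... | x , refl =
      up-dense B-stable x (T1-antitone F.I Bf⊆Cf x (proj₂ (pullback-up C-stable) x y∈C↑)) b Bb

  pullback-▷ : {B : Pred G.A} → GaloisStableA G.pol B → (T0 G.R B ∘ onA) ≐ T0 F.R (B ∘ onA)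
  pullback-▷ B-stable = (λ a a▷B b Bfb → R-reflect (a▷B (onA b) Bfb)) , ▷-dense B-stable

  pullbackValuation : Valuation G → Valuation F
  pullbackValuation V n =
    F.stableConcept (Concept.ext (V n) ∘ onA) (pullback-stable (G.ext-stable (V n)))

  pullback-⟦⟧ : (φ : Fml) (V : Valuation G) →
                (⟦_⟧ G φ V ∘ onA) ≐ ⟦_⟧ F φ (pullbackValuation V)
  pullback-⟦⟧ ⊥'       V = pullback-down (λ _ → ⊤)
  pullback-⟦⟧ ⊤'       V = ≐-refl
  pullback-⟦⟧ (var n)  V = ≐-refl
  pullback-⟦⟧ (φ ∧' ψ) V = ∩-resp-≐ (pullback-⟦⟧ φ V) (pullback-⟦⟧ ψ V)
  pullback-⟦⟧ (φ ∨' ψ) V = ≐-trans (pullback-down _)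
    (T0-resp-≐ F.I (∩-resp-≐ (pullback-up-⟦⟧ φ) (pullback-up-⟦⟧ ψ)))
    where
    pullback-up-⟦⟧ : (χ : Fml) →
                     (up G.pol (⟦_⟧ G χ V) ∘ onX) ≐ up F.pol (⟦_⟧ F χ (pullbackValuation V))
    pullback-up-⟦⟧ χ =
      ≐-trans (≐-sym (pullback-up (⟦⟧-stable G χ V))) (T1-resp-≐ F.I (pullback-⟦⟧ χ V))
  pullback-⟦⟧ (▷ φ)    V = ≐-trans (pullback-▷ (⟦⟧-stable G φ V))
    (T0-resp-≐ F.R (pullback-⟦⟧ φ V))

  reflect-validSeq : ∀ s → ValidSeq F s → ValidSeq G s
  reflect-validSeq (φ , ψ) φ⊢ψ V =
    pullback-reflects-⊆ (⟦⟧-stable G φ V) (⟦⟧-stable G ψ V)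
      (⊆-trans (proj₁ (pullback-⟦⟧ φ V))
        (⊆-trans (φ⊢ψ (pullbackValuation V)) (proj₂ (pullback-⟦⟧ ψ V))))

not-reflected⇒¬definable : {K : Context → Set} {F G : Context} →
                            DenseMorphism F G → K F → ¬ K G → ¬ ModallyDefinable K
not-reflected⇒¬definable {F = F} {G} m KF ¬KG (S , defines) =
  ¬KG (Equivalence.to (defines G) λ s s∈S →
    Pullback.reflect-validSeq m s (Equivalence.from (defines F) KF s s∈S))

module Reflexivity where
  data Two : Set where
    p q : Two

  ≢₂ : Two → Two → Set
  ≢₂ p q = ⊤
  ≢₂ q p = ⊤
  ≢₂ _ _ = ⊥

  Δ : Two → Two → Set
  Δ p p = ⊤
  Δ q q = ⊤
  Δ _ _ = ⊥

  Δ-sym : ∀ d e → Δ d e → Δ e d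
  Δ-sym p p _ = tt
  Δ-sym q q _ = tt

  P : Polarity
  P = record { A = Two ; X = Two ; I = ≢₂ }

  Δ-column-stable : ∀ e → GaloisStableA P (λ d → Δ d e)
  Δ-column-stable p = Galois.closed⇒stable P λ
    { p _ → tt ; q q∈cl → q∈cl q λ { p _ → tt ; q () } }
  Δ-column-stable q = Galois.closed⇒stable P λ
    { q _ → tt ; p p∈cl → p∈cl p λ { q _ → tt ; p () } }

  F : Context
  F = symmetricContext P Δ Δ-sym Δ-column-stable

  data Point : Set where
    ι : Two → Point
    ∗ : Point

  IG : Point → Two → Set
  IG (ι d) x = ≢₂ d x
  IG ∗     _ = ⊥

  RG : Point → Point → Set
  RG _     ∗     = ⊥
  RG ∗     _     = ⊥
  RG (ι d) (ι e) = Δ d e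

  RG-sym : ∀ u v → RG u v → RG v u
  RG-sym (ι d) (ι e) = Δ-sym d e

  PG : Polarity
  PG = record { A = Point ; X = Two ; I = IG }

  RG-column-stable : ∀ v → GaloisStableA PG (λ u → RG u v)
  RG-column-stable (ι p) = Galois.closed⇒stable PG λ
    { (ι p) _ → tt ; (ι q) q∈cl → q∈cl q separator ; ∗ ∗∈cl → ∗∈cl q separator }
    where
    separator : up PG (λ u → RG u (ι p)) q
    separator (ι p) _ = tt
  RG-column-stable (ι q) = Galois.closed⇒stable PG λ
    { (ι q) _ → tt ; (ι p) p∈cl → p∈cl p separator ; ∗ ∗∈cl → ∗∈cl p separator }
    where
    separator : up PG (λ u → RG u (ι q)) p
    separator (ι q) _ = tt
  RG-column-stable ∗ = Galois.closed⇒stable PG λ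
    { (ι p) p∈cl → p∈cl p λ _ () ; (ι q) q∈cl → q∈cl q λ _ () ; ∗ ∗∈cl → ∗∈cl p λ _ () }

  G : Context
  G = symmetricContext PG RG RG-sym RG-column-stable

  no-universal-feature : ∀ x → ¬ (∀ d → ≢₂ d x)
  no-universal-feature p I·p = I·p p
  no-universal-feature q I·q = I·q q

  no-universal-successor : ∀ d → ¬ (∀ e → Δ d e)
  no-universal-successor p Δp· = Δp· q
  no-universal-successor q Δq· = Δq· p

  ∗∈stable⇒full : {B : Pred Point} → GaloisStableA PG B → B ∗ → ∀ u → B u
  ∗∈stable⇒full B-stable = Galois.stable-∋-isolated⇒full PG B-stable λ _ ()

  ι-dense : DenseMorphism F G
  ι-dense = record
    { onA            = ι
    ; onX            = id
    ; onX-surjective = λ y → y , refl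
    ; I-preserve     = id
    ; I-reflect      = id
    ; R-reflect      = id
    ; up-dense       = up-dense
    ; ▷-dense        = ▷-dense
    }
    where
    up-dense : ∀ {B} → GaloisStableA PG B → up P (B ∘ ι) ⊆ up PG B
    up-dense B-stable x x∈Bι↑ (ι d) Bιd = x∈Bι↑ d Bιd
    up-dense B-stable x x∈Bι↑ ∗     B∗  = ⊥-elim (no-universal-feature x λ d →
      x∈Bι↑ d (∗∈stable⇒full B-stable B∗ (ι d)))

    ▷-dense : ∀ {B} → GaloisStableA PG B → T0 Δ (B ∘ ι) ⊆ (T0 RG B ∘ ι)
    ▷-dense B-stable d d▷Bι (ι e) Bιe = d▷Bι e Bιe
    ▷-dense B-stable d d▷Bι ∗     B∗  = no-universal-successor d λ e →
      d▷Bι e (∗∈stable⇒full B-stable B∗ (ι e))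

  F-reflexive : Reflexive F
  F-reflexive p = tt
  F-reflexive q = tt

  G-irreflexive : ¬ Reflexive G
  G-irreflexive R-refl = R-refl ∗

module Transitivity where
  P : Polarity
  P = record { A = ⊤ ; X = ⊤ ; I = λ _ _ → ⊥ }

  F : Context
  F = symmetricContext P (λ _ _ → ⊥) (λ _ _ → id) λ _ →
        Galois.closed⇒stable P λ _ tt∈cl → tt∈cl tt λ _ ()

  data Point : Set where
    top copy : Point

  IG : Point → ⊤ → Set
  IG top  _ = ⊤
  IG copy _ = ⊥

  RG : Point → Point → Set
  RG copy copy = ⊥
  RG _    _    = ⊤

  RG-sym : ∀ u v → RG u v → RG v u
  RG-sym top  top  _ = tt
  RG-sym top  copy _ = tt
  RG-sym copy top  _ = tt

  PG : Polarity
  PG = record { A = Point ; X = ⊤ ; I = IG }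

  RG-column-stable : ∀ v → GaloisStableA PG (λ u → RG u v)
  RG-column-stable top  = Galois.closed⇒stable PG λ { top _ → tt ; copy _ → tt }
  RG-column-stable copy = Galois.closed⇒stable PG λ
    { top _ → tt ; copy copy∈cl → copy∈cl tt λ { top _ → tt ; copy () } }

  G : Context
  G = symmetricContext PG RG RG-sym RG-column-stable

  copy-dense : DenseMorphism F G
  copy-dense = record
    { onA            = λ _ → copy
    ; onX            = id
    ; onX-surjective = λ y → y , refl
    ; I-preserve     = id
    ; I-reflect      = id
    ; R-reflect      = id
    ; up-dense       = λ _ x x∈B↑ → λ { top _ → tt ; copy Bcopy → x∈B↑ tt Bcopy }
    ; ▷-dense        = λ _ a a▷B → λ { top _ → tt ; copy Bcopy → a▷B tt Bcopy }
    }

  F-transitive : Transitive F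
  F-transitive _ _ _ ()

  G-intransitive : ¬ Transitive G
  G-intransitive R-trans = R-trans copy top copy tt tt

lemma2p5 : (¬ ModallyDefinable Reflexive) × (¬ ModallyDefinable Transitive)
lemma2p5 =
  not-reflected⇒¬definable ι-dense F-reflexive G-irreflexive ,
  not-reflected⇒¬definable copy-dense F-transitive G-intransitive
  where
  open Reflexivity using (ι-dense; F-reflexive; G-irreflexive)
  open Transitivity using (copy-dense; F-transitive; G-intransitive)
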